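{- Let $R$ be a unital commutative ring, $\mathcal{R}$ a finitely generated $R$-algebra with generating set $\{t_1,\dots,t_l\}$, $T=\{r_0+\sum_i r_it_i : r_i\in R\}$, $n\ge2$, $I=\{0,\dots,n\}$, and $K_{\{i\}}=\langle e_{j,j+1}(m): j\in I\setminus\{i\}, m\in T\rangle\le\operatorname{EL}_{n+1}(\mathcal{R})$ (indices mod $n+1$), with $K_\tau=\bigcap_{i\in\tau}K_{\{i\}}$. Let $0\le p<n$, $0\le i_0<i_1<\dots<i_p\le n$ and $\tau=I\setminus\{i_0,\dots,i_p\}$. Then $K_\tau$ consists of all matrices $A=(a_{k,j})$ with $a_{k,j}\in\{1\}$ if $k=j$; $a_{k,j}\in T^{j-k}$ if $k\ne j$ and $\{k,k+1,\dots,j-1\}\subseteq\{i_0,\dots,i_p\}$; $a_{k,j}\in\{0\}$ otherwise, where $j-k$ and the elements $k,k+1,\dots,j-1$ are taken modulo $n+1$.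
   Context: $e_{i,j}(r)$ ($i\ne j$) is the $(n+1)\times(n+1)$ matrix (rows/columns indexed $0,\dots,n$) with $1$'s on the diagonal, $r$ at $(i,j)$, $0$ elsewhere; $\operatorname{EL}_{n+1}(\mathcal{R})$ is the group they generate. $T^d$ denotes the $R$-module of polynomial expressions in $1,t_1,\dots,t_l$ of degree at most $d$; here $j-k$ is read as its residue in $\{1,\dots,n\}$, and $\{k,k+1,\dots,j-1\}$ is the cyclic interval modulo $n+1$. -}

module Defs where

open import Level using (Level; _⊔_) renaming (suc to lsuc)
open import Algebra.Bundles using (CommutativeRing; Ring)
open import Algebra.Morphism.Structures using (module RingMorphisms)
open import Data.Nat as ℕ using (ℕ; zero; suc; _∸_; _%_; _≤_; _<_)
open import Data.Nat.DivMod using (m%n<n)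
open import Data.Fin as F using (Fin; toℕ; fromℕ<)
open import Data.List using (List; length; foldr)
open import Data.List.Relation.Unary.All using (All)
open import Data.Product using (Σ; ∃; _×_; _,_; proj₂)
open import Relation.Binary.PropositionalEquality using (_≡_; _≢_)
open import Relation.Nullary using (¬_; yes; no)

record Algebra {c ℓ} (R : CommutativeRing c ℓ) (a ℓa : Level)
       : Set (c ⊔ ℓ ⊔ lsuc (a ⊔ ℓa)) where
  field
    ring      : Ring a ℓa
    ι         : CommutativeRing.Carrier R → Ring.Carrier ring
    ι-hom     : RingMorphisms.IsRingHomomorphism
                  (CommutativeRing.rawRing R) (Ring.rawRing ring) ι
    ι-central : ∀ r x → Ring._≈_ ring (Ring._*_ ring (ι r) x) (Ring._*_ ring x (ι r))

sucMod : ∀ {N} → Fin (suc N) → Fin (suc N)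
sucMod {N} j = fromℕ< (m%n<n (suc (toℕ j)) (suc N))

module _ {c ℓ a ℓa} {R : CommutativeRing c ℓ} (𝓐 : Algebra R a ℓa) where
  open Algebra 𝓐
  open Ring ring renaming (Carrier to A)
  private module R = CommutativeRing R

  Car : Set a
  Car = A

  ΣF : ∀ {N} → (Fin N → A) → A
  ΣF {zero}  f = 0#
  ΣF {suc N} f = f F.zero + ΣF (λ i → f (F.suc i))

  monomial : ∀ {l} → (Fin l → A) → List (Fin l) → A
  monomial t = foldr (λ i x → t i * x) 1#

  evalPoly : ∀ {l} → (Fin l → A) → List (R.Carrier × List (Fin l)) → A
  evalPoly t = foldr (λ { (r , w) x → ι r * monomial t w + x }) 0#

  -- T^d : polynomial expressions in 1, t₁,…,t_l of degree ≤ d, coefficients in R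
  Tpow : ∀ {l} → (Fin l → A) → ℕ → A → Set (c ⊔ ℓa)
  Tpow {l} t d x = Σ (List (R.Carrier × List (Fin l))) λ ps →
                     All (λ rw → length (proj₂ rw) ≤ d) ps × (evalPoly t ps ≈ x)

  Generates : ∀ {l} → (Fin l → A) → Set (a ⊔ c ⊔ ℓa)
  Generates t = ∀ x → ∃ λ d → Tpow t d x

  InT : ∀ {l} → (Fin l → A) → A → Set (c ⊔ ℓa)
  InT {l} t x = Σ (Fin (suc l) → R.Carrier) λ r →
                  x ≈ (ι (r F.zero) + ΣF (λ i → ι (r (F.suc i)) * t i))

  Mat : ℕ → Set a
  Mat N = Fin N → Fin N → A

  _≈M_ : ∀ {N} → Mat N → Mat N → Set ℓa
  X ≈M Y = ∀ k j → X k j ≈ Y k j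

  _*M_ : ∀ {N} → Mat N → Mat N → Mat N
  (X *M Y) k j = ΣF (λ m → X k m * Y m j)

  idM : ∀ {N} → Mat N
  idM k j with k F.≟ j
  ... | yes _ = 1#
  ... | no  _ = 0#

  elem : ∀ {N} → Fin N → Fin N → A → Mat N
  elem i j r k m with k F.≟ i | m F.≟ j
  ... | yes _ | yes _ = r
  ... | _     | _     = idM k m

  data ⟨_⟩ {s N} (S : Mat N → Set s) : Mat N → Set (a ⊔ ℓa ⊔ s) where
    gen  : ∀ {X} → S X → ⟨ S ⟩ X
    one  : ⟨ S ⟩ idM
    mul  : ∀ {X Y} → ⟨ S ⟩ X → ⟨ S ⟩ Y → ⟨ S ⟩ (X *M Y)
    inv  : ∀ {X Y} → ⟨ S ⟩ X → (X *M Y) ≈M idM → (Y *M X) ≈M idM → ⟨ S ⟩ Y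
    resp : ∀ {X Y} → ⟨ S ⟩ X → X ≈M Y → ⟨ S ⟩ Y

  Kgen : ∀ {l n} → (Fin l → A) → Fin (suc n) → Mat (suc n) → Set (a ⊔ c ⊔ ℓa)
  Kgen t i X = Σ _ λ j → Σ A λ m → (j ≢ i) × InT t m × (X ≈M elem j (sucMod j) m)

  K₁ : ∀ {l n} → (Fin l → A) → Fin (suc n) → Mat (suc n) → Set (a ⊔ c ⊔ ℓa)
  K₁ t i = ⟨ Kgen t i ⟩

  Kτ : ∀ {l n s} → (Fin l → A) → (Fin (suc n) → Set s) → Mat (suc n) → Set (a ⊔ c ⊔ ℓa ⊔ s)
  Kτ t τ X = ∀ i → τ i → K₁ t i X

  module Shape {l n p} (t : Fin l → A) (ind : Fin (suc p) → Fin (suc n)) where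
    -- j − k read as its residue in {0,…,n} (in {1,…,n} when k ≠ j)
    dist : Fin (suc n) → Fin (suc n) → ℕ
    dist k j = (toℕ j ℕ.+ suc n ∸ toℕ k) % suc n

    -- cyclic interval {k, k+1, …, j−1} ⊆ {i₀,…,i_p}
    CycIn : Fin (suc n) → Fin (suc n) → Set
    CycIn k j = ∀ m → m < dist k j → ∃ λ q → toℕ (ind q) ≡ (toℕ k ℕ.+ m) % suc n

    HasShape : Mat (suc n) → Set (c ⊔ ℓa)
    HasShape X = ∀ k j →
        (k ≡ j → X k j ≈ 1#)
      × (k ≢ j → CycIn k j → Tpow t (dist k j) (X k j))
      × (k ≢ j → ¬ CycIn k j → X k j ≈ 0#)

-- For an index i outside {i₀,…,i_p}, number the indices cyclically starting at i+1, so that i comes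
-- last and the rank of j+1 is one more than that of j for every j ≠ i. Then K_{i} is exactly the group
-- of matrices that are unitriangular for this order and have their (k,j) entry in T^(rank j − rank k):
-- the generators e_{j,j+1}(T) are of this form and T^a·T^b ⊆ T^(a+b) makes these matrices a group;
-- conversely the commutator relation e_{k,k′}(x)·e_{k′,j}(y) = e_{k,j}(xy)·e_{k′,j}(y)·e_{k,k′}(x) builds
-- every e_{k,j}(T^(rank j − rank k)) from the generators, and row reduction factors any such matrix into
-- these. Intersecting over the avoided indices i: position (k,j) lies above the diagonal for all of them
-- exactly when the cyclic interval k,…,j−1 contains none of them, and then rank j − rank k is the
-- cyclic distance j − k.

module Submission where

open import Defs
open import Level using (_⊔_)
open import Algebra.Bundles using (CommutativeRing; Ring)
open import Algebra.Morphism.Structures using (module RingMorphisms)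
open import Data.Nat as ℕ using (ℕ; zero; suc; _≤_; _<_; _∸_; _%_; z≤n; s≤s)
import Data.Nat.Properties as ℕ
open import Data.Fin as F using (Fin)
import Data.Fin.Properties as F
open import Data.List using (List; []; _∷_; _++_; length; map; tabulate)
open import Data.List.Relation.Unary.All as All using (All; []; _∷_)
import Data.List.Relation.Unary.All.Properties as All
import Data.List.Properties as List
open import Data.Product using (∃; _×_; _,_; proj₁; proj₂)
open import Data.Sum using (_⊎_; inj₁; inj₂)
open import Data.Empty using (⊥-elim)
open import Relation.Binary.Bundles using (Setoid)
open import Relation.Binary.Definitions using (Tri; tri<; tri≈; tri>)
import Relation.Binary.Reasoning.Setoid
open import Relation.Binary.PropositionalEquality as ≡ using (_≡_; _≢_)
open import Function using (_∘_)
open import Relation.Nullary using (¬_; Dec; yes; no)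

∸-telescope : ∀ {a b c} → a ≤ b → b ≤ c → (b ∸ a) ℕ.+ (c ∸ b) ≡ c ∸ a
∸-telescope {a} {b} {c} a≤b b≤c = ≡.sym (begin
  c ∸ a                ≡⟨ ≡.cong (_∸ a) (ℕ.m∸n+n≡m b≤c) ⟨
  (c ∸ b) ℕ.+ b ∸ a    ≡⟨ ℕ.+-∸-assoc (c ∸ b) a≤b ⟩
  (c ∸ b) ℕ.+ (b ∸ a)  ≡⟨ ℕ.+-comm (c ∸ b) (b ∸ a) ⟩
  (b ∸ a) ℕ.+ (c ∸ b)  ∎)
  where open ≡.≡-Reasoning

module _ {c ℓ a ℓa} {R : CommutativeRing c ℓ} (𝓐 : Algebra R a ℓa) where
  open Algebra 𝓐 using (ring; ι; ι-hom; ι-central)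
  open Ring ring renaming (Carrier to A)
  open import Algebra.Properties.Ring ring using (-0#≈0#; -‿distribˡ-*; -‿+-comm)
  open import Algebra.Properties.CommutativeSemigroup +-commutativeSemigroup
    using () renaming (interchange to +-interchange)

  private
    module R = CommutativeRing R
    module ι = RingMorphisms.IsRingHomomorphism ι-hom
    module ≈-Reasoning = Relation.Binary.Reasoning.Setoid setoid

    ∑ : ∀ {N} → (Fin N → A) → A
    ∑ = ΣF 𝓐

    _≈ᴹ_ : ∀ {N} → Mat 𝓐 N → Mat 𝓐 N → Set ℓa
    _≈ᴹ_ = _≈M_ 𝓐

    _*ᴹ_ : ∀ {N} → Mat 𝓐 N → Mat 𝓐 N → Mat 𝓐 N
    _*ᴹ_ = _*M_ 𝓐

    𝟙 : ∀ {N} → Mat 𝓐 N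
    𝟙 = idM 𝓐

    e : ∀ {N} → Fin N → Fin N → A → Mat 𝓐 N
    e = elem 𝓐

  infix  4 _≈ᴹ_
  infixl 7 _*ᴹ_

  ∑-cong : ∀ {N} {f g : Fin N → A} → (∀ i → f i ≈ g i) → ∑ f ≈ ∑ g
  ∑-cong {zero}  f≈g = refl
  ∑-cong {suc N} f≈g = +-cong (f≈g F.zero) (∑-cong (λ i → f≈g (F.suc i)))

  ∑-zero : ∀ {N} {f : Fin N → A} → (∀ i → f i ≈ 0#) → ∑ f ≈ 0#
  ∑-zero {zero}  f≈0 = refl
  ∑-zero {suc N} f≈0 = trans (+-cong (f≈0 F.zero) (∑-zero (λ i → f≈0 (F.suc i)))) (+-identityˡ 0#)

  ∑-+ : ∀ {N} (f g : Fin N → A) → ∑ (λ i → f i + g i) ≈ ∑ f + ∑ g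
  ∑-+ {zero}  f g = sym (+-identityˡ 0#)
  ∑-+ {suc N} f g = trans (+-cong refl (∑-+ (λ i → f (F.suc i)) (λ i → g (F.suc i)))) (+-interchange _ _ _ _)

  ∑-distribˡ : ∀ {N} x (f : Fin N → A) → x * ∑ f ≈ ∑ (λ i → x * f i)
  ∑-distribˡ {zero}  x f = zeroʳ x
  ∑-distribˡ {suc N} x f = trans (distribˡ x _ _) (+-cong refl (∑-distribˡ x (λ i → f (F.suc i))))

  ∑-distribʳ : ∀ {N} x (f : Fin N → A) → ∑ f * x ≈ ∑ (λ i → f i * x)
  ∑-distribʳ {zero}  x f = zeroˡ x
  ∑-distribʳ {suc N} x f = trans (distribʳ x _ _) (+-cong refl (∑-distribʳ x (λ i → f (F.suc i))))

  ∑-comm : ∀ {M N} (f : Fin M → Fin N → A) → ∑ (λ m → ∑ (f m)) ≈ ∑ (λ n → ∑ (λ m → f m n))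
  ∑-comm {zero} {N} f = sym (∑-zero {N} (λ _ → refl))
  ∑-comm {suc M} f = trans (+-cong refl (∑-comm (λ m → f (F.suc m))))
                           (sym (∑-+ (f F.zero) (λ n → ∑ (λ m → f (F.suc m) n))))

  ∑-point : ∀ {N} {f : Fin N → A} i → (∀ m → m ≢ i → f m ≈ 0#) → ∑ f ≈ f i
  ∑-point F.zero    f≈0 = trans (+-cong refl (∑-zero (λ m → f≈0 (F.suc m) λ ()))) (+-identityʳ _)
  ∑-point (F.suc i) f≈0 =
    trans (+-cong (f≈0 F.zero λ ()) (∑-point i (λ m m≢i → f≈0 (F.suc m) (m≢i ∘ F.suc-injective))))
          (+-identityˡ _)

  ∑-pair : ∀ {N} {f : Fin N → A} i j → i ≢ j → (∀ m → m ≢ i → m ≢ j → f m ≈ 0#) → ∑ f ≈ f i + f j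
  ∑-pair F.zero    F.zero    i≢j _   = ⊥-elim (i≢j ≡.refl)
  ∑-pair F.zero    (F.suc j) _   f≈0 =
    +-cong refl (∑-point j (λ m m≢j → f≈0 (F.suc m) (λ ()) (m≢j ∘ F.suc-injective)))
  ∑-pair (F.suc i) F.zero    _   f≈0 =
    trans (+-cong refl (∑-point i (λ m m≢i → f≈0 (F.suc m) (m≢i ∘ F.suc-injective) (λ ())))) (+-comm _ _)
  ∑-pair (F.suc i) (F.suc j) i≢j f≈0 =
    trans (+-cong (f≈0 F.zero (λ ()) (λ ()))
                  (∑-pair i j (i≢j ∘ ≡.cong F.suc)
                          (λ m m≢i m≢j → f≈0 (F.suc m) (m≢i ∘ F.suc-injective) (m≢j ∘ F.suc-injective))))
          (+-identityˡ _)

  ≈ᴹ-setoid : ℕ → Setoid a ℓa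
  ≈ᴹ-setoid N = record
    { Carrier       = Mat 𝓐 N
    ; _≈_           = _≈ᴹ_
    ; isEquivalence = record
      { refl  = λ _ _ → refl
      ; sym   = λ X≈Y k j → sym (X≈Y k j)
      ; trans = λ X≈Y Y≈Z k j → trans (X≈Y k j) (Y≈Z k j) } }

  module ≈ᴹ {N : ℕ} = Setoid (≈ᴹ-setoid N)

  *ᴹ-cong : ∀ {N} {X X′ Y Y′ : Mat 𝓐 N} → X ≈ᴹ X′ → Y ≈ᴹ Y′ → X *ᴹ Y ≈ᴹ X′ *ᴹ Y′
  *ᴹ-cong X≈X′ Y≈Y′ k j = ∑-cong (λ m → *-cong (X≈X′ k m) (Y≈Y′ m j))

  *ᴹ-assoc : ∀ {N} (X Y Z : Mat 𝓐 N) → (X *ᴹ Y) *ᴹ Z ≈ᴹ X *ᴹ (Y *ᴹ Z)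
  *ᴹ-assoc {N} X Y Z k j = begin
    ∑ (λ n → ∑ (λ m → X k m * Y m n) * Z n j)
      ≈⟨ ∑-cong (λ n → ∑-distribʳ (Z n j) (λ m → X k m * Y m n)) ⟩
    ∑ (λ n → ∑ (λ m → X k m * Y m n * Z n j))
      ≈⟨ ∑-comm (λ m n → X k m * Y m n * Z n j) ⟨
    ∑ (λ m → ∑ (λ n → X k m * Y m n * Z n j))
      ≈⟨ ∑-cong {N} (λ m → ∑-cong {N} (λ n → *-assoc (X k m) (Y m n) (Z n j))) ⟩
    ∑ (λ m → ∑ (λ n → X k m * (Y m n * Z n j)))
      ≈⟨ ∑-cong (λ m → ∑-distribˡ (X k m) (λ n → Y m n * Z n j)) ⟨
    ∑ (λ m → X k m * ∑ (λ n → Y m n * Z n j))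
      ∎
    where open ≈-Reasoning

  𝟙-diagonal : ∀ {N} (k : Fin N) → 𝟙 k k ≡ 1#
  𝟙-diagonal k with k F.≟ k
  ... | yes _   = ≡.refl
  ... | no  k≢k = ⊥-elim (k≢k ≡.refl)

  𝟙-offDiagonal : ∀ {N} {k j : Fin N} → k ≢ j → 𝟙 k j ≡ 0#
  𝟙-offDiagonal {k = k} {j} k≢j with k F.≟ j
  ... | yes k≡j = ⊥-elim (k≢j k≡j)
  ... | no  _   = ≡.refl

  *ᴹ-identityˡ : ∀ {N} (X : Mat 𝓐 N) → 𝟙 *ᴹ X ≈ᴹ X
  *ᴹ-identityˡ X k j = begin
    ∑ (λ m → 𝟙 k m * X m j) ≈⟨ ∑-point k (λ m m≢k → trans (*-cong (reflexive (𝟙-offDiagonal (m≢k ∘ ≡.sym))) refl) (zeroˡ _)) ⟩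
    𝟙 k k * X k j           ≈⟨ *-cong (reflexive (𝟙-diagonal k)) refl ⟩
    1# * X k j              ≈⟨ *-identityˡ _ ⟩
    X k j                   ∎
    where open ≈-Reasoning

  *ᴹ-identityʳ : ∀ {N} (X : Mat 𝓐 N) → X *ᴹ 𝟙 ≈ᴹ X
  *ᴹ-identityʳ X k j = begin
    ∑ (λ m → X k m * 𝟙 m j) ≈⟨ ∑-point j (λ m m≢j → trans (*-cong refl (reflexive (𝟙-offDiagonal m≢j))) (zeroʳ _)) ⟩
    X k j * 𝟙 j j           ≈⟨ *-cong refl (reflexive (𝟙-diagonal j)) ⟩
    X k j * 1#              ≈⟨ *-identityʳ _ ⟩
    X k j                   ∎
    where open ≈-Reasoning

  inverse-unique : ∀ {N} {X Y Z : Mat 𝓐 N} → Y *ᴹ X ≈ᴹ 𝟙 → X *ᴹ Z ≈ᴹ 𝟙 → Y ≈ᴹ Z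
  inverse-unique {X = X} {Y} {Z} YX≈𝟙 XZ≈𝟙 = begin
    Y              ≈⟨ *ᴹ-identityʳ Y ⟨
    Y *ᴹ 𝟙         ≈⟨ *ᴹ-cong ≈ᴹ.refl XZ≈𝟙 ⟨
    Y *ᴹ (X *ᴹ Z)  ≈⟨ *ᴹ-assoc Y X Z ⟨
    (Y *ᴹ X) *ᴹ Z  ≈⟨ *ᴹ-cong YX≈𝟙 ≈ᴹ.refl ⟩
    𝟙 *ᴹ Z         ≈⟨ *ᴹ-identityˡ Z ⟩
    Z              ∎
    where open Relation.Binary.Reasoning.Setoid (≈ᴹ-setoid _)

  ≈ᴹ-byRow : ∀ {N} {X Y : Mat 𝓐 N} a → (∀ c → X a c ≈ Y a c) →
             (∀ u → u ≢ a → ∀ c → X u c ≈ Y u c) → X ≈ᴹ Y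
  ≈ᴹ-byRow a rowₐ others u c with u F.≟ a
  ... | yes ≡.refl = rowₐ c
  ... | no  u≢a    = others u u≢a c

  elem-view : ∀ {N} (a b : Fin N) x k j → (k ≡ a × j ≡ b) ⊎ (e a b x k j ≡ 𝟙 k j)
  elem-view a b x k j with k F.≟ a | j F.≟ b
  ... | yes k≡a | yes j≡b = inj₁ (k≡a , j≡b)
  ... | yes _   | no  _   = inj₂ ≡.refl
  ... | no  _   | _       = inj₂ ≡.refl

  elem-hit : ∀ {N} (a b : Fin N) x → e a b x a b ≡ x
  elem-hit a b x with a F.≟ a | b F.≟ b
  ... | yes _   | yes _   = ≡.refl
  ... | no  a≢a | _       = ⊥-elim (a≢a ≡.refl)
  ... | yes _   | no  b≢b = ⊥-elim (b≢b ≡.refl)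

  elem-otherRow : ∀ {N} {a b u : Fin N} x c → u ≢ a → e a b x u c ≈ 𝟙 u c
  elem-otherRow {a = a} {b} {u} x c u≢a with elem-view a b x u c
  ... | inj₁ (u≡a , _) = ⊥-elim (u≢a u≡a)
  ... | inj₂ eq        = reflexive eq

  elem-otherColumn : ∀ {N} {a b c : Fin N} x u → c ≢ b → e a b x u c ≈ 𝟙 u c
  elem-otherColumn {a = a} {b} {c} x u c≢b with elem-view a b x u c
  ... | inj₁ (_ , c≡b) = ⊥-elim (c≢b c≡b)
  ... | inj₂ eq        = reflexive eq

  elem-*ᴹ-row : ∀ {N} {a b : Fin N} x (Y : Mat 𝓐 N) c → a ≢ b →
                (e a b x *ᴹ Y) a c ≈ Y a c + x * Y b c
  elem-*ᴹ-row {a = a} {b} x Y c a≢b = begin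
    ∑ (λ m → e a b x a m * Y m c)               ≈⟨ ∑-pair a b a≢b outside ⟩
    e a b x a a * Y a c + e a b x a b * Y b c   ≈⟨ +-cong (*-cong eₐₐ refl) (*-cong (reflexive (elem-hit a b x)) refl) ⟩
    1# * Y a c + x * Y b c                      ≈⟨ +-cong (*-identityˡ _) refl ⟩
    Y a c + x * Y b c                           ∎
    where
    open ≈-Reasoning
    eₐₐ : e a b x a a ≈ 1#
    eₐₐ = trans (elem-otherColumn x a a≢b) (reflexive (𝟙-diagonal a))
    outside : ∀ m → m ≢ a → m ≢ b → e a b x a m * Y m c ≈ 0#
    outside m m≢a m≢b =
      trans (*-cong (trans (elem-otherColumn x a m≢b) (reflexive (𝟙-offDiagonal (m≢a ∘ ≡.sym)))) refl) (zeroˡ _)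

  elem-*ᴹ-otherRow : ∀ {N} {a b u : Fin N} x (Y : Mat 𝓐 N) c → u ≢ a → (e a b x *ᴹ Y) u c ≈ Y u c
  elem-*ᴹ-otherRow x Y c u≢a =
    trans (∑-cong (λ m → *-cong (elem-otherRow x m u≢a) refl)) (*ᴹ-identityˡ Y _ c)

  elem-row : ∀ {N} {a b : Fin N} x c → a ≢ b → e a b x a c ≈ 𝟙 a c + x * 𝟙 b c
  elem-row {a = a} {b} x c a≢b = trans (sym (*ᴹ-identityʳ (e a b x) a c)) (elem-*ᴹ-row x 𝟙 c a≢b)

  elem-cong : ∀ {N} (a b : Fin N) {x y} → x ≈ y → e a b x ≈ᴹ e a b y
  elem-cong a b x≈y u c with u F.≟ a | c F.≟ b
  ... | yes _ | yes _ = x≈y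
  ... | yes _ | no  _ = refl
  ... | no  _ | _     = refl

  elem-zero : ∀ {N} {a b : Fin N} → a ≢ b → e a b 0# ≈ᴹ 𝟙
  elem-zero {a = a} {b} a≢b u c with u F.≟ a | c F.≟ b
  ... | yes ≡.refl | yes ≡.refl = sym (reflexive (𝟙-offDiagonal a≢b))
  ... | yes _      | no  _      = refl
  ... | no  _      | _          = refl

  elem-+ : ∀ {N} {a b : Fin N} x y → a ≢ b → e a b x *ᴹ e a b y ≈ᴹ e a b (x + y)
  elem-+ {a = a} {b} x y a≢b = ≈ᴹ-byRow a rowₐ others
    where
    open ≈-Reasoning
    rowₐ : ∀ c → (e a b x *ᴹ e a b y) a c ≈ e a b (x + y) a c
    rowₐ c = begin
      (e a b x *ᴹ e a b y) a c             ≈⟨ elem-*ᴹ-row x (e a b y) c a≢b ⟩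
      e a b y a c + x * e a b y b c        ≈⟨ +-cong (elem-row y c a≢b) (*-cong refl (elem-otherRow y c (a≢b ∘ ≡.sym))) ⟩
      (𝟙 a c + y * 𝟙 b c) + x * 𝟙 b c     ≈⟨ +-assoc _ _ _ ⟩
      𝟙 a c + (y * 𝟙 b c + x * 𝟙 b c)     ≈⟨ +-cong refl (trans (+-comm _ _) (sym (distribʳ _ x y))) ⟩
      𝟙 a c + (x + y) * 𝟙 b c             ≈⟨ elem-row (x + y) c a≢b ⟨
      e a b (x + y) a c                    ∎
    others : ∀ u → u ≢ a → ∀ c → (e a b x *ᴹ e a b y) u c ≈ e a b (x + y) u c
    others u u≢a c = trans (elem-*ᴹ-otherRow x (e a b y) c u≢a)
                           (trans (elem-otherRow y c u≢a) (sym (elem-otherRow (x + y) c u≢a)))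

  elem-inverseʳ : ∀ {N} {a b : Fin N} x → a ≢ b → e a b x *ᴹ e a b (- x) ≈ᴹ 𝟙
  elem-inverseʳ {a = a} {b} x a≢b =
    ≈ᴹ.trans (elem-+ x (- x) a≢b) (≈ᴹ.trans (elem-cong a b (-‿inverseʳ x)) (elem-zero a≢b))

  elem-inverseˡ : ∀ {N} {a b : Fin N} x → a ≢ b → e a b (- x) *ᴹ e a b x ≈ᴹ 𝟙
  elem-inverseˡ {a = a} {b} x a≢b =
    ≈ᴹ.trans (elem-+ (- x) x a≢b) (≈ᴹ.trans (elem-cong a b (-‿inverseˡ x)) (elem-zero a≢b))

  *ᴹ-inverse : ∀ {N} {X X′ Y Y′ : Mat 𝓐 N} → X *ᴹ X′ ≈ᴹ 𝟙 → Y *ᴹ Y′ ≈ᴹ 𝟙 → (X *ᴹ Y) *ᴹ (Y′ *ᴹ X′) ≈ᴹ 𝟙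
  *ᴹ-inverse {X = X} {X′} {Y} {Y′} XX′≈𝟙 YY′≈𝟙 = begin
    (X *ᴹ Y) *ᴹ (Y′ *ᴹ X′)  ≈⟨ *ᴹ-assoc X Y (Y′ *ᴹ X′) ⟩
    X *ᴹ (Y *ᴹ (Y′ *ᴹ X′))  ≈⟨ *ᴹ-cong ≈ᴹ.refl (*ᴹ-assoc Y Y′ X′) ⟨
    X *ᴹ ((Y *ᴹ Y′) *ᴹ X′)  ≈⟨ *ᴹ-cong ≈ᴹ.refl (*ᴹ-cong YY′≈𝟙 ≈ᴹ.refl) ⟩
    X *ᴹ (𝟙 *ᴹ X′)          ≈⟨ *ᴹ-cong ≈ᴹ.refl (*ᴹ-identityˡ X′) ⟩
    X *ᴹ X′                 ≈⟨ XX′≈𝟙 ⟩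
    𝟙                       ∎
    where open Relation.Binary.Reasoning.Setoid (≈ᴹ-setoid _)

  steinberg-relation : ∀ {N} {k k′ j : Fin N} x y → k ≢ k′ → k′ ≢ j → k ≢ j →
    e k k′ x *ᴹ e k′ j y ≈ᴹ e k j (x * y) *ᴹ (e k′ j y *ᴹ e k k′ x)
  steinberg-relation {k = k} {k′} {j} x y k≢k′ k′≢j k≢j = ≈ᴹ-byRow k rowₖ others
    where
    open ≈-Reasoning
    P : Mat 𝓐 _
    P = e k′ j y *ᴹ e k k′ x
    rowₖ : ∀ c → (e k k′ x *ᴹ e k′ j y) k c ≈ (e k j (x * y) *ᴹ P) k c
    rowₖ c = begin
      (e k k′ x *ᴹ e k′ j y) k c                 ≈⟨ elem-*ᴹ-row x (e k′ j y) c k≢k′ ⟩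
      e k′ j y k c + x * e k′ j y k′ c           ≈⟨ +-cong (elem-otherRow y c k≢k′) (*-cong refl (elem-row y c k′≢j)) ⟩
      𝟙 k c + x * (𝟙 k′ c + y * 𝟙 j c)           ≈⟨ +-cong refl (trans (distribˡ x _ _) (+-cong refl (sym (*-assoc x y _)))) ⟩
      𝟙 k c + (x * 𝟙 k′ c + (x * y) * 𝟙 j c)     ≈⟨ +-assoc _ _ _ ⟨
      (𝟙 k c + x * 𝟙 k′ c) + (x * y) * 𝟙 j c     ≈⟨ +-cong Pₖ (*-cong refl Pⱼ) ⟨
      P k c + (x * y) * P j c                    ≈⟨ elem-*ᴹ-row (x * y) P c k≢j ⟨
      (e k j (x * y) *ᴹ P) k c                   ∎
      where
      Pₖ : P k c ≈ 𝟙 k c + x * 𝟙 k′ c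
      Pₖ = trans (elem-*ᴹ-otherRow y (e k k′ x) c k≢k′) (elem-row x c k≢k′)
      Pⱼ : P j c ≈ 𝟙 j c
      Pⱼ = trans (elem-*ᴹ-otherRow y (e k k′ x) c (k′≢j ∘ ≡.sym)) (elem-otherRow x c (k≢j ∘ ≡.sym))
    others : ∀ u → u ≢ k → ∀ c → (e k k′ x *ᴹ e k′ j y) u c ≈ (e k j (x * y) *ᴹ P) u c
    others u u≢k c = begin
      (e k k′ x *ᴹ e k′ j y) u c  ≈⟨ elem-*ᴹ-otherRow x (e k′ j y) c u≢k ⟩
      e k′ j y u c                ≈⟨ rowᵤ (u F.≟ k′) ⟩
      P u c                       ≈⟨ elem-*ᴹ-otherRow (x * y) P c u≢k ⟨
      (e k j (x * y) *ᴹ P) u c    ∎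
      where
      rowᵤ : Dec (u ≡ k′) → e k′ j y u c ≈ P u c
      rowᵤ (yes ≡.refl) = begin
        e k′ j y k′ c                  ≈⟨ elem-row y c k′≢j ⟩
        𝟙 k′ c + y * 𝟙 j c             ≈⟨ +-cong (elem-otherRow x c u≢k) (*-cong refl (elem-otherRow x c (k≢j ∘ ≡.sym))) ⟨
        e k k′ x k′ c + y * e k k′ x j c ≈⟨ elem-*ᴹ-row y (e k k′ x) c k′≢j ⟨
        P k′ c                         ∎
      rowᵤ (no u≢k′) = trans (elem-otherRow y c u≢k′)
                             (sym (trans (elem-*ᴹ-otherRow y (e k k′ x) c u≢k′) (elem-otherRow x c u≢k)))

  module _ {s N} {S : Mat 𝓐 N → Set s} where

    elem∈⟨⟩-zero : ∀ {a b} → a ≢ b → ⟨_⟩ 𝓐 S (e a b 0#)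
    elem∈⟨⟩-zero a≢b = resp one (≈ᴹ.sym (elem-zero a≢b))

    elem∈⟨⟩-cong : ∀ {a b x y} → x ≈ y → ⟨_⟩ 𝓐 S (e a b x) → ⟨_⟩ 𝓐 S (e a b y)
    elem∈⟨⟩-cong {a} {b} x≈y x∈ = resp x∈ (elem-cong a b x≈y)

    elem∈⟨⟩-+ : ∀ {a b x y} → a ≢ b → ⟨_⟩ 𝓐 S (e a b x) → ⟨_⟩ 𝓐 S (e a b y) → ⟨_⟩ 𝓐 S (e a b (x + y))
    elem∈⟨⟩-+ {x = x} {y} a≢b x∈ y∈ = resp (mul x∈ y∈) (elem-+ x y a≢b)

    elem∈⟨⟩-neg : ∀ {a b x} → a ≢ b → ⟨_⟩ 𝓐 S (e a b x) → ⟨_⟩ 𝓐 S (e a b (- x))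
    elem∈⟨⟩-neg {x = x} a≢b x∈ = inv x∈ (elem-inverseʳ x a≢b) (elem-inverseˡ x a≢b)

    elem∈⟨⟩-* : ∀ {k k′ j x y} → k ≢ k′ → k′ ≢ j → k ≢ j →
                ⟨_⟩ 𝓐 S (e k k′ x) → ⟨_⟩ 𝓐 S (e k′ j y) → ⟨_⟩ 𝓐 S (e k j (x * y))
    elem∈⟨⟩-* {k} {k′} {j} {x} {y} k≢k′ k′≢j k≢j x∈ y∈ =
      resp (mul (mul x∈ y∈) (mul (elem∈⟨⟩-neg k≢k′ x∈) (elem∈⟨⟩-neg k′≢j y∈))) commutator
      where
      open Relation.Binary.Reasoning.Setoid (≈ᴹ-setoid N)
      P P⁻¹ : Mat 𝓐 N
      P   = e k′ j y *ᴹ e k k′ x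
      P⁻¹ = e k k′ (- x) *ᴹ e k′ j (- y)
      commutator : (e k k′ x *ᴹ e k′ j y) *ᴹ P⁻¹ ≈ᴹ e k j (x * y)
      commutator = begin
        (e k k′ x *ᴹ e k′ j y) *ᴹ P⁻¹  ≈⟨ *ᴹ-cong (steinberg-relation x y k≢k′ k′≢j k≢j) ≈ᴹ.refl ⟩
        (e k j (x * y) *ᴹ P) *ᴹ P⁻¹    ≈⟨ *ᴹ-assoc _ P P⁻¹ ⟩
        e k j (x * y) *ᴹ (P *ᴹ P⁻¹)    ≈⟨ *ᴹ-cong ≈ᴹ.refl (*ᴹ-inverse (elem-inverseʳ y k′≢j) (elem-inverseʳ x k≢k′)) ⟩
        e k j (x * y) *ᴹ 𝟙             ≈⟨ *ᴹ-identityʳ _ ⟩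
        e k j (x * y)                  ∎

  module Degree {l} (t : Fin l → A) where

    private
      Term : Set c
      Term = R.Carrier × List (Fin l)

      mon : List (Fin l) → A
      mon = monomial 𝓐 t

      poly : List Term → A
      poly = evalPoly 𝓐 t

      term : Term → A
      term (r , w) = ι r * mon w

      T : ℕ → A → Set (c ⊔ ℓa)
      T = Tpow 𝓐 t

      Bounded : ℕ → List Term → Set c
      Bounded d = All (λ rw → length (proj₂ rw) ≤ d)

    monomial-++ : ∀ w v → mon (w ++ v) ≈ mon w * mon v
    monomial-++ []      v = sym (*-identityˡ _)
    monomial-++ (i ∷ w) v = trans (*-cong refl (monomial-++ w v)) (sym (*-assoc _ _ _))

    poly-++ : ∀ ps qs → poly (ps ++ qs) ≈ poly ps + poly qs
    poly-++ []       qs = sym (+-identityˡ _)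
    poly-++ (p ∷ ps) qs = trans (+-cong refl (poly-++ ps qs)) (sym (+-assoc _ _ _))

    Tpow-resp : ∀ {d x y} → x ≈ y → T d x → T d y
    Tpow-resp x≈y (ps , bd , ps≈x) = ps , bd , trans ps≈x x≈y

    Tpow-zero : ∀ d → T d 0#
    Tpow-zero d = [] , [] , refl

    Tpow-monomial : ∀ {d} ρ w → length w ≤ d → T d (ι ρ * mon w)
    Tpow-monomial ρ w |w|≤d = (ρ , w) ∷ [] , |w|≤d ∷ [] , +-identityʳ _

    Tpow-one : T 0 1#
    Tpow-one = Tpow-resp (trans (*-cong ι.1#-homo refl) (*-identityˡ 1#)) (Tpow-monomial R.1# [] z≤n)

    Tpow-mono : ∀ {d d′ x} → d ≤ d′ → T d x → T d′ x
    Tpow-mono d≤d′ (ps , bd , ps≈x) = ps , All.map (λ |w|≤d → ℕ.≤-trans |w|≤d d≤d′) bd , ps≈x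

    Tpow-+ : ∀ {d x y} → T d x → T d y → T d (x + y)
    Tpow-+ (ps , bp , ps≈x) (qs , bq , qs≈y) = ps ++ qs , All.++⁺ bp bq , trans (poly-++ ps qs) (+-cong ps≈x qs≈y)

    Tpow-neg : ∀ {d x} → T d x → T d (- x)
    Tpow-neg {x = x} (ps , bd , ps≈x) = map negate ps , All.map⁺ bd , trans (poly-negate ps) (-‿cong ps≈x)
      where
      negate : Term → Term
      negate (r , w) = R.- r , w
      poly-negate : ∀ ps → poly (map negate ps) ≈ - poly ps
      poly-negate []             = sym -0#≈0#
      poly-negate ((r , w) ∷ ps) =
        trans (+-cong (trans (*-cong (ι.-‿homo r) refl) (sym (-‿distribˡ-* _ _))) (poly-negate ps))
              (-‿+-comm _ _)

    Tpow-∑ : ∀ {d N} {f : Fin N → A} → (∀ m → T d (f m)) → T d (∑ f)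
    Tpow-∑ {d} {zero}  f∈ = Tpow-zero d
    Tpow-∑ {d} {suc N} f∈ = Tpow-+ (f∈ F.zero) (Tpow-∑ (λ m → f∈ (F.suc m)))

    Tpow-* : ∀ {d d′ x y} → T d x → T d′ y → T (d ℕ.+ d′) (x * y)
    Tpow-* (ps , bp , ps≈x) (qs , bq , qs≈y) = ps ⊛ qs , bounded-⊛ ps bp bq , trans (poly-⊛ ps qs) (*-cong ps≈x qs≈y)
      where
      _·_ : Term → Term → Term
      (r , w) · (s , v) = r R.* s , w ++ v

      term-· : ∀ u v → term (u · v) ≈ term u * term v
      term-· (r , w) (s , v) = begin
        ι (r R.* s) * mon (w ++ v)      ≈⟨ *-cong (ι.*-homo r s) (monomial-++ w v) ⟩
        (ι r * ι s) * (mon w * mon v)   ≈⟨ *-assoc _ _ _ ⟩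
        ι r * (ι s * (mon w * mon v))   ≈⟨ *-cong refl (sym (*-assoc _ _ _)) ⟩
        ι r * ((ι s * mon w) * mon v)   ≈⟨ *-cong refl (*-cong (ι-central s (mon w)) refl) ⟩
        ι r * ((mon w * ι s) * mon v)   ≈⟨ *-cong refl (*-assoc _ _ _) ⟩
        ι r * (mon w * (ι s * mon v))   ≈⟨ sym (*-assoc _ _ _) ⟩
        (ι r * mon w) * (ι s * mon v)   ∎
        where open ≈-Reasoning

      poly-map-· : ∀ u qs → poly (map (u ·_) qs) ≈ term u * poly qs
      poly-map-· u []       = sym (zeroʳ _)
      poly-map-· u (v ∷ qs) = trans (+-cong (term-· u v) (poly-map-· u qs)) (sym (distribˡ _ _ _))

      _⊛_ : List Term → List Term → List Term
      []       ⊛ qs = []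
      (u ∷ ps) ⊛ qs = map (u ·_) qs ++ ps ⊛ qs

      poly-⊛ : ∀ ps qs → poly (ps ⊛ qs) ≈ poly ps * poly qs
      poly-⊛ []       qs = sym (zeroˡ _)
      poly-⊛ (u ∷ ps) qs = trans (poly-++ (map (u ·_) qs) (ps ⊛ qs))
                                 (trans (+-cong (poly-map-· u qs) (poly-⊛ ps qs)) (sym (distribʳ _ _ _)))

      bounded-⊛ : ∀ {d d′} ps {qs} → Bounded d ps → Bounded d′ qs → Bounded (d ℕ.+ d′) (ps ⊛ qs)
      bounded-⊛ []            []       bq = []
      bounded-⊛ ((r , w) ∷ ps) (bu ∷ bp) bq =
        All.++⁺ (All.map⁺ (All.map (λ bv → ℕ.≤-trans (ℕ.≤-reflexive (List.length-++ w)) (ℕ.+-mono-≤ bu bv)) bq))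
                (bounded-⊛ ps bp bq)

    InT⇒Tpow1 : ∀ {x} → InT 𝓐 t x → T 1 x
    InT⇒Tpow1 (r , x≈) =
      (r F.zero , []) ∷ tabulate linear , z≤n ∷ All.tabulate⁺ (λ _ → s≤s z≤n) ,
      trans (+-cong (*-identityʳ _) (trans (poly-tabulate linear) (∑-cong {l} (λ i → *-cong refl (*-identityʳ _))))) (sym x≈)
      where
      linear : Fin l → Term
      linear i = r (F.suc i) , i ∷ []
      poly-tabulate : ∀ {N} (f : Fin N → Term) → poly (tabulate f) ≈ ∑ (λ i → term (f i))
      poly-tabulate {zero}  f = refl
      poly-tabulate {suc N} f = +-cong refl (poly-tabulate (λ i → f (F.suc i)))

    InT-monomial : ∀ ρ w → length w ≤ 1 → InT 𝓐 t (ι ρ * mon w)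
    InT-monomial ρ []          _ = coefficient , sym (begin
      ι ρ + ∑ (λ i → ι R.0# * t i) ≈⟨ +-cong refl (∑-zero {l} (λ i → trans (*-cong ι.0#-homo refl) (zeroˡ _))) ⟩
      ι ρ + 0#                     ≈⟨ +-identityʳ _ ⟩
      ι ρ                          ≈⟨ *-identityʳ _ ⟨
      ι ρ * 1#                     ∎)
      where
      open ≈-Reasoning
      coefficient : Fin (suc l) → R.Carrier
      coefficient F.zero    = ρ
      coefficient (F.suc _) = R.0#
    InT-monomial ρ (h ∷ [])    _ = coefficient , sym (begin
      ι R.0# + ∑ (λ i → ι (coefficient (F.suc i)) * t i) ≈⟨ +-cong ι.0#-homo (∑-point h others) ⟩
      0# + ι (coefficient (F.suc h)) * t h              ≈⟨ +-identityˡ _ ⟩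
      ι (coefficient (F.suc h)) * t h                   ≈⟨ *-cong (reflexive (≡.cong ι atH)) (sym (*-identityʳ _)) ⟩
      ι ρ * (t h * 1#)                                  ∎)
      where
      open ≈-Reasoning
      coefficient : Fin (suc l) → R.Carrier
      coefficient F.zero    = R.0#
      coefficient (F.suc i) with i F.≟ h
      ... | yes _ = ρ
      ... | no  _ = R.0#
      atH : coefficient (F.suc h) ≡ ρ
      atH with h F.≟ h
      ... | yes _   = ≡.refl
      ... | no  h≢h = ⊥-elim (h≢h ≡.refl)
      others : ∀ i → i ≢ h → ι (coefficient (F.suc i)) * t i ≈ 0#
      others i i≢h with i F.≟ h
      ... | yes i≡h = ⊥-elim (i≢h i≡h)
      ... | no  _   = trans (*-cong ι.0#-homo refl) (zeroˡ _)
    InT-monomial ρ (_ ∷ _ ∷ _) (s≤s ())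

    Tpow-induction : ∀ {p} (P : A → Set p) → (∀ {x y} → x ≈ y → P x → P y) → P 0# →
                     (∀ {x y} → P x → P y → P (x + y)) →
                     ∀ {d} → (∀ ρ w → length w ≤ d → P (ι ρ * mon w)) → ∀ {x} → T d x → P x
    Tpow-induction P resp-P P0 P+ {d} Pterm (ps , bd , ps≈x) = resp-P ps≈x (go ps bd)
      where
      go : ∀ ps → Bounded d ps → P (poly ps)
      go []             []        = P0
      go ((ρ , w) ∷ ps) (bw ∷ bd) = P+ (Pterm ρ w bw) (go ps bd)

  module Unitriangular {l} (t : Fin l → A) {N} (r : Fin N → ℕ) (r-injective : ∀ {a b} → r a ≡ r b → a ≡ b) where
    open Degree t

    record IsUnitriangular (X : Mat 𝓐 N) : Set (c ⊔ ℓa) where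
      field
        diagonal : ∀ k → X k k ≈ 1#
        above    : ∀ k j → r k < r j → Tpow 𝓐 t (r j ∸ r k) (X k j)
        below    : ∀ k j → r j < r k → X k j ≈ 0#

      above-or-on : ∀ k j → r k ≤ r j → Tpow 𝓐 t (r j ∸ r k) (X k j)
      above-or-on k j rk≤rj with ℕ.m≤n⇒m<n∨m≡n rk≤rj
      ... | inj₁ rk<rj = above k j rk<rj
      ... | inj₂ rk≡rj with r-injective rk≡rj
      ...   | ≡.refl = Tpow-mono z≤n (Tpow-resp (sym (diagonal k)) Tpow-one)

    open IsUnitriangular

    <⇒≢ : ∀ {k j} → r k < r j → k ≢ j
    <⇒≢ rk<rj ≡.refl = ℕ.<-irrefl ≡.refl rk<rj

    unitriangular-resp : ∀ {X Y} → X ≈ᴹ Y → IsUnitriangular X → IsUnitriangular Y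
    unitriangular-resp X≈Y U = record
      { diagonal = λ k → trans (sym (X≈Y k k)) (diagonal U k)
      ; above    = λ k j rk<rj → Tpow-resp (X≈Y k j) (above U k j rk<rj)
      ; below    = λ k j rj<rk → trans (sym (X≈Y k j)) (below U k j rj<rk) }

    𝟙-unitriangular : IsUnitriangular 𝟙
    𝟙-unitriangular = record
      { diagonal = λ k → reflexive (𝟙-diagonal k)
      ; above    = λ k j rk<rj → Tpow-resp (sym (reflexive (𝟙-offDiagonal (<⇒≢ rk<rj)))) (Tpow-zero _)
      ; below    = λ k j rj<rk → reflexive (𝟙-offDiagonal (<⇒≢ rj<rk ∘ ≡.sym)) }

    elem-unitriangular : ∀ {a b x} → r a < r b → Tpow 𝓐 t (r b ∸ r a) x → IsUnitriangular (e a b x)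
    elem-unitriangular {a} {b} {x} ra<rb x∈ = record { diagonal = diagonal′ ; above = above′ ; below = below′ }
      where
      diagonal′ : ∀ k → e a b x k k ≈ 1#
      diagonal′ k with elem-view a b x k k
      ... | inj₁ (≡.refl , ≡.refl) = ⊥-elim (ℕ.<-irrefl ≡.refl ra<rb)
      ... | inj₂ eq                = reflexive (≡.trans eq (𝟙-diagonal k))
      above′ : ∀ k j → r k < r j → Tpow 𝓐 t (r j ∸ r k) (e a b x k j)
      above′ k j rk<rj with elem-view a b x k j
      ... | inj₁ (≡.refl , ≡.refl) = Tpow-resp (reflexive (≡.sym (elem-hit a b x))) x∈
      ... | inj₂ eq = Tpow-resp (reflexive (≡.sym (≡.trans eq (𝟙-offDiagonal (<⇒≢ rk<rj))))) (Tpow-zero _)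
      below′ : ∀ k j → r j < r k → e a b x k j ≈ 0#
      below′ k j rj<rk with elem-view a b x k j
      ... | inj₁ (≡.refl , ≡.refl) = ⊥-elim (ℕ.<-asym ra<rb rj<rk)
      ... | inj₂ eq                = reflexive (≡.trans eq (𝟙-offDiagonal (<⇒≢ rj<rk ∘ ≡.sym)))

    *ᴹ-unitriangular : ∀ {X Y} → IsUnitriangular X → IsUnitriangular Y → IsUnitriangular (X *ᴹ Y)
    *ᴹ-unitriangular {X} {Y} UX UY = record { diagonal = diagonal′ ; above = above′ ; below = below′ }
      where
      summand : ∀ k m j → (X k m * Y m j ≈ 0#) ⊎ (r k ≤ r m × r m ≤ r j)
      summand k m j with r m ℕ.<? r k | r j ℕ.<? r m
      ... | yes rm<rk | _         = inj₁ (trans (*-cong (below UX k m rm<rk) refl) (zeroˡ _))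
      ... | no  _     | yes rj<rm = inj₁ (trans (*-cong refl (below UY m j rj<rm)) (zeroʳ _))
      ... | no  rm≮rk | no  rj≮rm = inj₂ (ℕ.≮⇒≥ rm≮rk , ℕ.≮⇒≥ rj≮rm)

      diagonal′ : ∀ k → (X *ᴹ Y) k k ≈ 1#
      diagonal′ k = trans (∑-point k offDiagonal) (trans (*-cong (diagonal UX k) (diagonal UY k)) (*-identityˡ 1#))
        where
        offDiagonal : ∀ m → m ≢ k → X k m * Y m k ≈ 0#
        offDiagonal m m≢k with summand k m k
        ... | inj₁ ≈0            = ≈0
        ... | inj₂ (rk≤rm , rm≤rk) = ⊥-elim (m≢k (r-injective (ℕ.≤-antisym rm≤rk rk≤rm)))

      above′ : ∀ k j → r k < r j → Tpow 𝓐 t (r j ∸ r k) ((X *ᴹ Y) k j)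
      above′ k j _ = Tpow-∑ entry
        where
        entry : ∀ m → Tpow 𝓐 t (r j ∸ r k) (X k m * Y m j)
        entry m with summand k m j
        ... | inj₁ ≈0 = Tpow-resp (sym ≈0) (Tpow-zero _)
        ... | inj₂ (rk≤rm , rm≤rj) =
          ≡.subst (λ d → Tpow 𝓐 t d (X k m * Y m j)) (∸-telescope rk≤rm rm≤rj)
                  (Tpow-* (above-or-on UX k m rk≤rm) (above-or-on UY m j rm≤rj))

      below′ : ∀ k j → r j < r k → (X *ᴹ Y) k j ≈ 0#
      below′ k j rj<rk = ∑-zero entry
        where
        entry : ∀ m → X k m * Y m j ≈ 0#
        entry m with summand k m j
        ... | inj₁ ≈0              = ≈0
        ... | inj₂ (rk≤rm , rm≤rj) = ⊥-elim (ℕ.<-irrefl ≡.refl (ℕ.<-≤-trans rj<rk (ℕ.≤-trans rk≤rm rm≤rj)))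

    -- The inverse is part of the data because closure under the inv constructor of ⟨_⟩ needs it.
    record UnitriangularUnit (X : Mat 𝓐 N) : Set (a ⊔ c ⊔ ℓa) where
      field
        unitriangular         : IsUnitriangular X
        inverse               : Mat 𝓐 N
        inverse-unitriangular : IsUnitriangular inverse
        inverseʳ              : X *ᴹ inverse ≈ᴹ 𝟙
        inverseˡ              : inverse *ᴹ X ≈ᴹ 𝟙

    ⟨⟩-unitriangularUnit : ∀ {s} {S : Mat 𝓐 N → Set s} → (∀ {X} → S X → UnitriangularUnit X) →
                           ∀ {X} → ⟨_⟩ 𝓐 S X → UnitriangularUnit X
    ⟨⟩-unitriangularUnit S⊆ (gen X∈S) = S⊆ X∈S
    ⟨⟩-unitriangularUnit S⊆ one = record
      { unitriangular = 𝟙-unitriangular ; inverse = 𝟙 ; inverse-unitriangular = 𝟙-unitriangular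
      ; inverseʳ = *ᴹ-identityˡ 𝟙 ; inverseˡ = *ᴹ-identityˡ 𝟙 }
    ⟨⟩-unitriangularUnit S⊆ (mul X∈ Y∈) = record
      { unitriangular         = *ᴹ-unitriangular (unitriangular X) (unitriangular Y)
      ; inverse               = inverse Y *ᴹ inverse X
      ; inverse-unitriangular = *ᴹ-unitriangular (inverse-unitriangular Y) (inverse-unitriangular X)
      ; inverseʳ              = *ᴹ-inverse (inverseʳ X) (inverseʳ Y)
      ; inverseˡ              = *ᴹ-inverse (inverseˡ Y) (inverseˡ X) }
      where
      open UnitriangularUnit
      X = ⟨⟩-unitriangularUnit S⊆ X∈
      Y = ⟨⟩-unitriangularUnit S⊆ Y∈
    ⟨⟩-unitriangularUnit S⊆ (inv {X} {Y} X∈ XY≈𝟙 YX≈𝟙) = record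
      { unitriangular         = unitriangular-resp (≈ᴹ.sym (inverse-unique YX≈𝟙 (inverseʳ X⁺))) (inverse-unitriangular X⁺)
      ; inverse               = X
      ; inverse-unitriangular = unitriangular X⁺
      ; inverseʳ              = YX≈𝟙
      ; inverseˡ              = XY≈𝟙 }
      where
      open UnitriangularUnit
      X⁺ = ⟨⟩-unitriangularUnit S⊆ X∈
    ⟨⟩-unitriangularUnit S⊆ (resp X∈ X≈Y) = record
      { unitriangular         = unitriangular-resp X≈Y (unitriangular X)
      ; inverse               = inverse X
      ; inverse-unitriangular = inverse-unitriangular X
      ; inverseʳ              = ≈ᴹ.trans (*ᴹ-cong (≈ᴹ.sym X≈Y) ≈ᴹ.refl) (inverseʳ X)
      ; inverseˡ              = ≈ᴹ.trans (*ᴹ-cong ≈ᴹ.refl (≈ᴹ.sym X≈Y)) (inverseˡ X) }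
      where
      open UnitriangularUnit
      X = ⟨⟩-unitriangularUnit S⊆ X∈

  module SubgroupK {l} (t : Fin l → A) {n} (i : Fin (suc n))
    (r : Fin (suc n) → ℕ) (r-injective : ∀ {a b} → r a ≡ r b → a ≡ b)
    (r-suc : ∀ j → j ≢ i → r (sucMod j) ≡ suc (r j)) where
    open Degree t
    open Unitriangular t r r-injective
    open IsUnitriangular

    private
      K : Mat 𝓐 (suc n) → Set (a ⊔ c ⊔ ℓa)
      K = K₁ 𝓐 t i

    generator-unitriangularUnit : ∀ {X} → Kgen 𝓐 t i X → UnitriangularUnit X
    generator-unitriangularUnit {X} (j , m , j≢i , m∈T , X≈) = record
      { unitriangular         = unitriangular-resp (≈ᴹ.sym X≈) (elem-unitriangular rj<rj′ (degree (InT⇒Tpow1 m∈T)))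
      ; inverse               = e j j′ (- m)
      ; inverse-unitriangular = elem-unitriangular rj<rj′ (degree (Tpow-neg (InT⇒Tpow1 m∈T)))
      ; inverseʳ              = ≈ᴹ.trans (*ᴹ-cong {Y = e j j′ (- m)} X≈ ≈ᴹ.refl) (elem-inverseʳ m j≢j′)
      ; inverseˡ              = ≈ᴹ.trans (*ᴹ-cong {X = e j j′ (- m)} ≈ᴹ.refl X≈) (elem-inverseˡ m j≢j′) }
      where
      j′ = sucMod j
      rj′≡ : r j′ ≡ suc (r j)
      rj′≡ = r-suc j j≢i
      rj<rj′ : r j < r j′
      rj<rj′ = ℕ.≤-reflexive (≡.sym rj′≡)
      j≢j′ : j ≢ j′
      j≢j′ = <⇒≢ rj<rj′
      degree : ∀ {x} → Tpow 𝓐 t 1 x → Tpow 𝓐 t (r j′ ∸ r j) x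
      degree {x} = ≡.subst (λ d → Tpow 𝓐 t d x) (≡.sym (≡.trans (≡.cong (_∸ r j) rj′≡) (ℕ.m+n∸n≡m 1 (r j))))

    K⇒unitriangular : ∀ {X} → K X → IsUnitriangular X
    K⇒unitriangular X∈K = UnitriangularUnit.unitriangular (⟨⟩-unitriangularUnit generator-unitriangularUnit X∈K)

    module _ (r-bound : ∀ x → r x ≤ n) (r-top : r i ≡ n)
             (r-surjective : ∀ c → c ≤ n → ∃ λ x → r x ≡ c) where

      <⇒≢i : ∀ {k j} → r k < r j → k ≢ i
      <⇒≢i {j = j} rk<rj ≡.refl = ℕ.<-irrefl ≡.refl (ℕ.<-≤-trans (≡.subst (_< r j) r-top rk<rj) (r-bound j))

      sucMod-of-rank : ∀ {k j} → r j ≡ suc (r k) → sucMod k ≡ j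
      sucMod-of-rank {k} rj≡ = r-injective (≡.trans (r-suc k (<⇒≢i (ℕ.≤-reflexive (≡.sym rj≡)))) (≡.sym rj≡))

      monomial∈K : ∀ d {k j} → r j ≡ suc d ℕ.+ r k → ∀ ρ w → length w ≤ suc d →
                   K (e k j (ι ρ * monomial 𝓐 t w))
      monomial-split∈K : ∀ d {k j} → r j ≡ suc (suc d) ℕ.+ r k → ∀ ρ hd tl → length hd ≤ 1 → length tl ≤ suc d →
                         K (e k j (ι ρ * monomial 𝓐 t (hd ++ tl)))

      monomial∈K zero {k} rj≡ ρ w |w|≤1 =
        ≡.subst (λ j → K (e k j _)) (sucMod-of-rank rj≡) (gen (k , _ , k≢i , InT-monomial ρ w |w|≤1 , ≈ᴹ.refl))
        where
        k≢i : k ≢ i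
        k≢i = <⇒≢i (ℕ.≤-reflexive (≡.sym rj≡))
      monomial∈K (suc d) rj≡ ρ []      _          = monomial-split∈K d rj≡ ρ [] [] z≤n z≤n
      monomial∈K (suc d) rj≡ ρ (h ∷ w) (s≤s |w|≤) = monomial-split∈K d rj≡ ρ (h ∷ []) w (s≤s z≤n) |w|≤

      monomial-split∈K d {k} {j} rj≡ ρ hd tl |hd|≤1 |tl|≤ =
        elem∈⟨⟩-cong product (elem∈⟨⟩-* k≢k′ k′≢j k≢j first second)
        where
        k′ = sucMod k
        rk<rj : r k < r j
        rk<rj = ℕ.≤-trans (s≤s (ℕ.m≤n+m (r k) (suc d))) (ℕ.≤-reflexive (≡.sym rj≡))
        rk′≡ : r k′ ≡ suc (r k)
        rk′≡ = r-suc k (<⇒≢i rk<rj)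
        rj≡′ : r j ≡ suc d ℕ.+ r k′
        rj≡′ = ≡.trans rj≡ (≡.trans (≡.sym (ℕ.+-suc (suc d) (r k))) (≡.cong (suc d ℕ.+_) (≡.sym rk′≡)))
        k≢k′ : k ≢ k′
        k≢k′ = <⇒≢ (ℕ.≤-reflexive (≡.sym rk′≡))
        k′≢j : k′ ≢ j
        k′≢j = <⇒≢ (ℕ.≤-trans (s≤s (ℕ.m≤n+m (r k′) d)) (ℕ.≤-reflexive (≡.sym rj≡′)))
        k≢j : k ≢ j
        k≢j = <⇒≢ rk<rj
        first : K (e k k′ (ι ρ * monomial 𝓐 t hd))
        first = gen (k , _ , <⇒≢i rk<rj , InT-monomial ρ hd |hd|≤1 , ≈ᴹ.refl)
        second : K (e k′ j (monomial 𝓐 t tl))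
        second = elem∈⟨⟩-cong (trans (*-cong ι.1#-homo refl) (*-identityˡ _)) (monomial∈K d rj≡′ R.1# tl |tl|≤)
        product : (ι ρ * monomial 𝓐 t hd) * monomial 𝓐 t tl ≈ ι ρ * monomial 𝓐 t (hd ++ tl)
        product = trans (*-assoc _ _ _) (*-cong refl (sym (monomial-++ hd tl)))

      elem∈K : ∀ {k j x} → r k < r j → Tpow 𝓐 t (r j ∸ r k) x → K (e k j x)
      elem∈K {k} {j} {x} rk<rj x∈ =
        Tpow-induction (λ y → K (e k j y)) elem∈⟨⟩-cong (elem∈⟨⟩-zero (<⇒≢ rk<rj)) (elem∈⟨⟩-+ (<⇒≢ rk<rj))
          (monomial∈K d distance) (≡.subst (λ d → Tpow 𝓐 t d x) (ℕ.+-∸-assoc 1 rk<rj) x∈)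
        where
        d = r j ∸ suc (r k)
        distance : r j ≡ suc d ℕ.+ r k
        distance = ≡.trans (≡.sym (ℕ.m+[n∸m]≡n rk<rj)) (≡.cong suc (ℕ.+-comm (r k) d))

      -- Row reduction clears row after row, and each row by increasing column rank: left multiplication
      -- by e_{k,j}(−X k j) changes only row k, and there only the columns of rank ≥ rank j.
      ClearedBefore : ℕ → ℕ → Mat 𝓐 (suc n) → Set ℓa
      ClearedBefore k₀ c₀ X = ∀ u c → r u < r c → (F.toℕ u < k₀ ⊎ (F.toℕ u ≡ k₀ × r c < c₀)) → X u c ≈ 0#

      cleared-nextRow : ∀ {k₀ X} → ClearedBefore k₀ (suc n) X → ClearedBefore (suc k₀) 0 X
      cleared-nextRow cl u c ru<rc (inj₁ u<1+k₀) with ℕ.m<1+n⇒m<n∨m≡n u<1+k₀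
      ... | inj₁ u<k₀ = cl u c ru<rc (inj₁ u<k₀)
      ... | inj₂ u≡k₀ = cl u c ru<rc (inj₂ (u≡k₀ , s≤s (r-bound c)))

      cleared⇒𝟙 : ∀ {X} → IsUnitriangular X → ClearedBefore (suc n) 0 X → 𝟙 ≈ᴹ X
      cleared⇒𝟙 U cl u c with ℕ.<-cmp (r u) (r c)
      ... | tri< ru<rc _ _ = trans (reflexive (𝟙-offDiagonal (<⇒≢ ru<rc))) (sym (cl u c ru<rc (inj₁ (F.toℕ<n u))))
      ... | tri≈ _ ru≡rc _ with r-injective ru≡rc
      ...   | ≡.refl = trans (reflexive (𝟙-diagonal u)) (sym (diagonal U u))
      cleared⇒𝟙 U cl u c | tri> _ _ rc<ru = trans (reflexive (𝟙-offDiagonal (<⇒≢ rc<ru ∘ ≡.sym))) (sym (below U u c rc<ru))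

      clear-entry : ∀ {k₀ c₀ X} → k₀ < suc n → c₀ ≤ n → IsUnitriangular X → ClearedBefore k₀ c₀ X →
                    ∃ λ Y → IsUnitriangular Y × ClearedBefore k₀ (suc c₀) Y × (K Y → K X)
      clear-entry {k₀} {c₀} {X} k₀<N c₀≤n U cl = clear (r k ℕ.<? r j)
        where
        k = F.fromℕ< k₀<N
        j = proj₁ (r-surjective c₀ c₀≤n)
        rj≡c₀ : r j ≡ c₀
        rj≡c₀ = proj₂ (r-surjective c₀ c₀≤n)
        k≡ : ∀ {u} → F.toℕ u ≡ k₀ → u ≡ k
        k≡ u≡k₀ = F.toℕ-injective (≡.trans u≡k₀ (≡.sym (F.toℕ-fromℕ< k₀<N)))
        j≡ : ∀ {c} → r c ≡ c₀ → c ≡ j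
        j≡ rc≡c₀ = r-injective (≡.trans rc≡c₀ (≡.sym rj≡c₀))

        clear : Dec (r k < r j) → ∃ λ Y → IsUnitriangular Y × ClearedBefore k₀ (suc c₀) Y × (K Y → K X)
        clear (no rk≮rj) = X , U , cleared , λ X∈K → X∈K
          where
          cleared : ClearedBefore k₀ (suc c₀) X
          cleared u c ru<rc (inj₁ u<k₀) = cl u c ru<rc (inj₁ u<k₀)
          cleared u c ru<rc (inj₂ (u≡k₀ , rc<1+c₀)) with ℕ.m<1+n⇒m<n∨m≡n rc<1+c₀
          ... | inj₁ rc<c₀ = cl u c ru<rc (inj₂ (u≡k₀ , rc<c₀))
          ... | inj₂ rc≡c₀ with k≡ u≡k₀ | j≡ rc≡c₀
          ...   | ≡.refl | ≡.refl = ⊥-elim (rk≮rj ru<rc)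
        clear (yes rk<rj) = e k j (- x) *ᴹ X , unitriangular , cleared , X∈K
          where
          x = X k j
          x∈ = above U k j rk<rj
          k≢j = <⇒≢ rk<rj
          unitriangular : IsUnitriangular (e k j (- x) *ᴹ X)
          unitriangular = *ᴹ-unitriangular (elem-unitriangular rk<rj (Tpow-neg x∈)) U
          rowₖ : ∀ c → r k < r c → r c < suc c₀ → X k c + - x * X j c ≈ 0#
          rowₖ c rk<rc rc<1+c₀ with ℕ.m<1+n⇒m<n∨m≡n rc<1+c₀
          ... | inj₁ rc<c₀ =
            trans (+-cong (cl k c rk<rc (inj₂ (F.toℕ-fromℕ< k₀<N , rc<c₀)))
                          (trans (*-cong refl (below U j c (≡.subst (r c <_) (≡.sym rj≡c₀) rc<c₀))) (zeroʳ _)))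
                  (+-identityˡ 0#)
          ... | inj₂ rc≡c₀ with j≡ rc≡c₀
          ...   | ≡.refl = trans (+-cong refl (trans (*-cong refl (diagonal U j)) (*-identityʳ _))) (-‿inverseʳ x)
          cleared : ClearedBefore k₀ (suc c₀) (e k j (- x) *ᴹ X)
          cleared u c ru<rc = entry (u F.≟ k)
            where
            entry : Dec (u ≡ k) → F.toℕ u < k₀ ⊎ (F.toℕ u ≡ k₀ × r c < suc c₀) → (e k j (- x) *ᴹ X) u c ≈ 0#
            entry (no u≢k)    (inj₁ u<k₀)            = trans (elem-*ᴹ-otherRow (- x) X c u≢k) (cl u c ru<rc (inj₁ u<k₀))
            entry (no u≢k)    (inj₂ (u≡k₀ , _))      = ⊥-elim (u≢k (k≡ u≡k₀))
            entry (yes ≡.refl) (inj₁ k<k₀)           = ⊥-elim (ℕ.<-irrefl (F.toℕ-fromℕ< k₀<N) k<k₀)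
            entry (yes ≡.refl) (inj₂ (_ , rc<1+c₀)) = trans (elem-*ᴹ-row (- x) X c k≢j) (rowₖ c ru<rc rc<1+c₀)
          X∈K : K (e k j (- x) *ᴹ X) → K X
          X∈K Y∈K = resp (mul (elem∈K rk<rj x∈) Y∈K) (begin
            e k j x *ᴹ (e k j (- x) *ᴹ X)  ≈⟨ *ᴹ-assoc (e k j x) (e k j (- x)) X ⟨
            (e k j x *ᴹ e k j (- x)) *ᴹ X  ≈⟨ *ᴹ-cong {Y = X} (elem-inverseʳ x k≢j) ≈ᴹ.refl ⟩
            𝟙 *ᴹ X                         ≈⟨ *ᴹ-identityˡ X ⟩
            X                              ∎)
            where open Relation.Binary.Reasoning.Setoid (≈ᴹ-setoid (suc n))

      clearRow : ∀ g {k₀ c₀} → g ℕ.+ c₀ ≡ suc n → k₀ < suc n →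
                 (∀ {Y} → IsUnitriangular Y → ClearedBefore k₀ (suc n) Y → K Y) →
                 ∀ {X} → IsUnitriangular X → ClearedBefore k₀ c₀ X → K X
      clearRow zero    ≡.refl _ rest U cl = rest U cl
      clearRow (suc g) {k₀} {c₀} g+c₀≡ k₀<N rest U cl with clear-entry k₀<N c₀≤n U cl
        where
        c₀≤n : c₀ ≤ n
        c₀≤n = ℕ.≤-trans (ℕ.m≤n+m c₀ g) (ℕ.≤-reflexive (ℕ.suc-injective g+c₀≡))
      ... | _ , UY , clY , K⇒ = K⇒ (clearRow g (≡.trans (ℕ.+-suc g c₀) g+c₀≡) k₀<N rest UY clY)

      clearRows : ∀ g {k₀} → g ℕ.+ k₀ ≡ suc n → ∀ {X} → IsUnitriangular X → ClearedBefore k₀ 0 X → K X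
      clearRows zero    ≡.refl U cl = resp one (cleared⇒𝟙 U cl)
      clearRows (suc g) {k₀} g+k₀≡ U cl =
        clearRow (suc n) (ℕ.+-identityʳ _) k₀<N
                 (λ UY clY → clearRows g (≡.trans (ℕ.+-suc g k₀) g+k₀≡) UY (cleared-nextRow clY)) U cl
        where
        k₀<N : k₀ < suc n
        k₀<N = ℕ.≤-trans (s≤s (ℕ.m≤n+m k₀ g)) (ℕ.≤-reflexive g+k₀≡)

      unitriangular⇒K : ∀ {X} → IsUnitriangular X → K X
      unitriangular⇒K U = clearRows (suc n) (ℕ.+-identityʳ _) U λ { _ _ _ (inj₁ ()) ; _ _ _ (inj₂ (_ , ())) }

module CyclicOrder (n : ℕ) where
  open import Data.Nat.DivMod using (m%n<n; m<n⇒m%n≡m; [m+n]%n≡m%n; %-distribˡ-+; m%n%n≡m%n)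

  -- The paper's j − k: Shape.dist k j unfolds to δ (toℕ k) (toℕ j).
  δ : ℕ → ℕ → ℕ
  δ a b = (b ℕ.+ suc n ∸ a) % suc n

  %-absorbˡ : ∀ m k → (m % suc n ℕ.+ k) % suc n ≡ (m ℕ.+ k) % suc n
  %-absorbˡ m k = begin
    (m % suc n ℕ.+ k) % suc n                  ≡⟨ %-distribˡ-+ (m % suc n) k (suc n) ⟩
    (m % suc n % suc n ℕ.+ k % suc n) % suc n  ≡⟨ ≡.cong (λ x → (x ℕ.+ k % suc n) % suc n) (m%n%n≡m%n m (suc n)) ⟩
    (m % suc n ℕ.+ k % suc n) % suc n          ≡⟨ %-distribˡ-+ m k (suc n) ⟨
    (m ℕ.+ k) % suc n                          ∎
    where open ≡.≡-Reasoning

  δ-< : ∀ a b → δ a b < suc n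
  δ-< a b = m%n<n (b ℕ.+ suc n ∸ a) (suc n)

  +δ : ∀ {a b} → a < suc n → b < suc n → (a ℕ.+ δ a b) % suc n ≡ b
  +δ {a} {b} a<N b<N = begin
    (a ℕ.+ δ a b) % suc n                  ≡⟨ ≡.cong (_% suc n) (ℕ.+-comm a (δ a b)) ⟩
    (δ a b ℕ.+ a) % suc n                  ≡⟨ %-absorbˡ (b ℕ.+ suc n ∸ a) a ⟩
    (b ℕ.+ suc n ∸ a ℕ.+ a) % suc n        ≡⟨ ≡.cong (_% suc n) (ℕ.m∸n+n≡m (ℕ.≤-trans (ℕ.<⇒≤ a<N) (ℕ.m≤n+m (suc n) b))) ⟩
    (b ℕ.+ suc n) % suc n                  ≡⟨ [m+n]%n≡m%n b (suc n) ⟩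
    b % suc n                              ≡⟨ m<n⇒m%n≡m b<N ⟩
    b                                      ∎
    where open ≡.≡-Reasoning

  δ-unique : ∀ {a e} → a < suc n → e < suc n → δ a ((a ℕ.+ e) % suc n) ≡ e
  δ-unique {a} {e} a<N e<N = begin
    ((a ℕ.+ e) % suc n ℕ.+ suc n ∸ a) % suc n    ≡⟨ ≡.cong (_% suc n) (ℕ.+-∸-assoc ((a ℕ.+ e) % suc n) (ℕ.<⇒≤ a<N)) ⟩
    ((a ℕ.+ e) % suc n ℕ.+ (suc n ∸ a)) % suc n  ≡⟨ %-absorbˡ (a ℕ.+ e) (suc n ∸ a) ⟩
    (a ℕ.+ e ℕ.+ (suc n ∸ a)) % suc n            ≡⟨ ≡.cong (_% suc n) shuffle ⟩
    (e ℕ.+ suc n) % suc n                        ≡⟨ [m+n]%n≡m%n e (suc n) ⟩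
    e % suc n                                    ≡⟨ m<n⇒m%n≡m e<N ⟩
    e                                            ∎
    where
    open ≡.≡-Reasoning
    shuffle : a ℕ.+ e ℕ.+ (suc n ∸ a) ≡ e ℕ.+ suc n
    shuffle = ≡.trans (≡.cong (ℕ._+ (suc n ∸ a)) (ℕ.+-comm a e))
                      (≡.trans (ℕ.+-assoc e a _) (≡.cong (e ℕ.+_) (ℕ.m+[n∸m]≡n (ℕ.<⇒≤ a<N))))

  δ-via : ∀ {s a b e} → s < suc n → a < suc n → b < suc n → e < suc n →
          δ s a ℕ.+ e ≡ δ s b ⊎ δ s a ℕ.+ e ≡ δ s b ℕ.+ suc n → δ a b ≡ e
  δ-via {s} {a} {b} {e} s<N a<N b<N e<N sum = ≡.trans (≡.cong (δ a) (≡.sym a+e≡b)) (δ-unique a<N e<N)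
    where
    open ≡.≡-Reasoning
    reduce : ∀ {x} → x ≡ δ s b ⊎ x ≡ δ s b ℕ.+ suc n → (s ℕ.+ x) % suc n ≡ b
    reduce (inj₁ ≡.refl) = +δ s<N b<N
    reduce (inj₂ ≡.refl) = begin
      (s ℕ.+ (δ s b ℕ.+ suc n)) % suc n   ≡⟨ ≡.cong (_% suc n) (ℕ.+-assoc s (δ s b) (suc n)) ⟨
      (s ℕ.+ δ s b ℕ.+ suc n) % suc n     ≡⟨ [m+n]%n≡m%n (s ℕ.+ δ s b) (suc n) ⟩
      (s ℕ.+ δ s b) % suc n               ≡⟨ +δ s<N b<N ⟩
      b                                   ∎
    a+e≡b : (a ℕ.+ e) % suc n ≡ b
    a+e≡b = begin
      (a ℕ.+ e) % suc n                     ≡⟨ ≡.cong (λ x → (x ℕ.+ e) % suc n) (+δ s<N a<N) ⟨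
      ((s ℕ.+ δ s a) % suc n ℕ.+ e) % suc n ≡⟨ %-absorbˡ (s ℕ.+ δ s a) e ⟩
      (s ℕ.+ δ s a ℕ.+ e) % suc n           ≡⟨ ≡.cong (_% suc n) (ℕ.+-assoc s (δ s a) e) ⟩
      (s ℕ.+ (δ s a ℕ.+ e)) % suc n         ≡⟨ reduce sum ⟩
      b                                     ∎

  module Rank (i : Fin (suc n)) where

    private
      s : ℕ
      s = F.toℕ (sucMod i)

      s<N : s < suc n
      s<N = F.toℕ<n (sucMod i)

    toℕ-sucMod : ∀ (j : Fin (suc n)) → F.toℕ (sucMod j) ≡ suc (F.toℕ j) % suc n
    toℕ-sucMod j = F.toℕ-fromℕ< _

    rank : Fin (suc n) → ℕ
    rank x = δ s (F.toℕ x)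

    δ-via-rank : ∀ {a b e} → e < suc n → rank a ℕ.+ e ≡ rank b ⊎ rank a ℕ.+ e ≡ rank b ℕ.+ suc n →
                 δ (F.toℕ a) (F.toℕ b) ≡ e
    δ-via-rank {a} {b} = δ-via s<N (F.toℕ<n a) (F.toℕ<n b)

    rank-injective : ∀ {a b} → rank a ≡ rank b → a ≡ b
    rank-injective {a} {b} ra≡rb = F.toℕ-injective (begin
      F.toℕ a                   ≡⟨ +δ s<N (F.toℕ<n a) ⟨
      (s ℕ.+ rank a) % suc n    ≡⟨ ≡.cong (λ x → (s ℕ.+ x) % suc n) ra≡rb ⟩
      (s ℕ.+ rank b) % suc n    ≡⟨ +δ s<N (F.toℕ<n b) ⟩
      F.toℕ b                   ∎)
      where open ≡.≡-Reasoning

    rank-bound : ∀ x → rank x ≤ n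
    rank-bound x = ℕ.≤-pred (δ-< s (F.toℕ x))

    rank-top : rank i ≡ n
    rank-top = ≡.trans (≡.cong (δ s) (≡.sym s+n≡i)) (δ-unique s<N ℕ.≤-refl)
      where
      open ≡.≡-Reasoning
      s+n≡i : (s ℕ.+ n) % suc n ≡ F.toℕ i
      s+n≡i = begin
        (s ℕ.+ n) % suc n                        ≡⟨ ≡.cong (λ x → (x ℕ.+ n) % suc n) (toℕ-sucMod i) ⟩
        (suc (F.toℕ i) % suc n ℕ.+ n) % suc n    ≡⟨ %-absorbˡ (suc (F.toℕ i)) n ⟩
        (suc (F.toℕ i) ℕ.+ n) % suc n            ≡⟨ ≡.cong (_% suc n) (ℕ.+-suc (F.toℕ i) n) ⟨
        (F.toℕ i ℕ.+ suc n) % suc n              ≡⟨ [m+n]%n≡m%n (F.toℕ i) (suc n) ⟩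
        F.toℕ i % suc n                          ≡⟨ m<n⇒m%n≡m (F.toℕ<n i) ⟩
        F.toℕ i                                  ∎

    rank-suc : ∀ j → j ≢ i → rank (sucMod j) ≡ suc (rank j)
    rank-suc j j≢i = ≡.trans (≡.cong (δ s) (≡.sym s+1+rj≡)) (δ-unique s<N (s≤s rj<n))
      where
      open ≡.≡-Reasoning
      rj<n : rank j < n
      rj<n = ℕ.≤∧≢⇒< (rank-bound j) (λ rj≡n → j≢i (rank-injective (≡.trans rj≡n (≡.sym rank-top))))
      s+1+rj≡ : (s ℕ.+ suc (rank j)) % suc n ≡ F.toℕ (sucMod j)
      s+1+rj≡ = begin
        (s ℕ.+ suc (rank j)) % suc n             ≡⟨ ≡.cong (_% suc n) (≡.trans (ℕ.+-suc s (rank j)) (ℕ.+-comm 1 _)) ⟩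
        ((s ℕ.+ rank j) ℕ.+ 1) % suc n           ≡⟨ %-absorbˡ (s ℕ.+ rank j) 1 ⟨
        ((s ℕ.+ rank j) % suc n ℕ.+ 1) % suc n   ≡⟨ ≡.cong (λ x → (x ℕ.+ 1) % suc n) (+δ s<N (F.toℕ<n j)) ⟩
        (F.toℕ j ℕ.+ 1) % suc n                  ≡⟨ ≡.cong (_% suc n) (ℕ.+-comm (F.toℕ j) 1) ⟩
        suc (F.toℕ j) % suc n                    ≡⟨ toℕ-sucMod j ⟨
        F.toℕ (sucMod j)                         ∎

    rank-surjective : ∀ c → c ≤ n → ∃ λ x → rank x ≡ c
    rank-surjective c c≤n = F.fromℕ< (m%n<n (s ℕ.+ c) (suc n)) ,
      ≡.trans (≡.cong (δ s) (F.toℕ-fromℕ< _)) (δ-unique s<N (s≤s c≤n))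

    δ-ascending : ∀ {k j} → rank k ≤ rank j → δ (F.toℕ k) (F.toℕ j) ≡ rank j ∸ rank k
    δ-ascending {k} {j} rk≤rj =
      δ-via-rank (ℕ.≤-<-trans (ℕ.m∸n≤m (rank j) (rank k)) (δ-< s (F.toℕ j))) (inj₁ (ℕ.m+[n∸m]≡n rk≤rj))

    δ-descending : ∀ {k j} → rank j < rank k → δ (F.toℕ k) (F.toℕ j) ≡ rank j ℕ.+ suc n ∸ rank k
    δ-descending {k} {j} rj<rk = δ-via-rank e<N (inj₂ (ℕ.m+[n∸m]≡n rk≤rj+N))
      where
      rk≤rj+N : rank k ≤ rank j ℕ.+ suc n
      rk≤rj+N = ℕ.≤-trans (ℕ.<⇒≤ (δ-< s (F.toℕ k))) (ℕ.m≤n+m (suc n) (rank j))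
      e<N : rank j ℕ.+ suc n ∸ rank k < suc n
      e<N = ℕ.+-cancelˡ-< (rank k) _ _
              (≡.subst (_< rank k ℕ.+ suc n) (≡.sym (ℕ.m+[n∸m]≡n rk≤rj+N)) (ℕ.+-monoˡ-< (suc n) rj<rk))

    δ-to-i : ∀ k → δ (F.toℕ k) (F.toℕ i) ≡ n ∸ rank k
    δ-to-i k = ≡.trans (δ-ascending (≡.subst (rank k ≤_) (≡.sym rank-top) (rank-bound k))) (≡.cong (_∸ rank k) rank-top)

    -- Walking forward from k, one meets i before reaching j exactly when rank i j < rank i k.
    descending⇒passes-i : ∀ {k j} → rank j < rank k → δ (F.toℕ k) (F.toℕ i) < δ (F.toℕ k) (F.toℕ j)
    descending⇒passes-i {k} {j} rj<rk = ≡.subst₂ _<_ (≡.sym (δ-to-i k)) (≡.sym (δ-descending rj<rk))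
      (ℕ.∸-monoˡ-< (ℕ.≤-trans (ℕ.n<1+n n) (ℕ.m≤n+m (suc n) (rank j))) (rank-bound k))

    ascending⇒avoids-i : ∀ {k j m} → rank k < rank j → m < δ (F.toℕ k) (F.toℕ j) → (F.toℕ k ℕ.+ m) % suc n ≢ F.toℕ i
    ascending⇒avoids-i {k} {j} {m} rk<rj m<δ k+m≡i = ℕ.<-irrefl (≡.sym δki≡m) (ℕ.<-≤-trans m<δ δkj≤δki)
      where
      δki≡m : δ (F.toℕ k) (F.toℕ i) ≡ m
      δki≡m = ≡.trans (≡.cong (δ (F.toℕ k)) (≡.sym k+m≡i))
                      (δ-unique (F.toℕ<n k) (ℕ.<-trans m<δ (δ-< (F.toℕ k) (F.toℕ j))))
      δkj≤δki : δ (F.toℕ k) (F.toℕ j) ≤ δ (F.toℕ k) (F.toℕ i)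
      δkj≤δki = ≡.subst₂ _≤_ (≡.sym (δ-ascending (ℕ.<⇒≤ rk<rj))) (≡.sym (δ-to-i k))
                         (ℕ.∸-monoˡ-≤ (rank k) (rank-bound j))

module _ {c ℓ a ℓa} {R : CommutativeRing c ℓ} (𝓐 : Algebra R a ℓa) {l} (t : Fin l → Car 𝓐)
         {n p} (ind : Fin (suc p) → Fin (suc n)) where
  open Algebra 𝓐 using (ring)
  open Ring ring using (_≈_; 0#; 1#; sym)
  open CyclicOrder n
  open Rank using (rank; rank-injective)
  open Shape 𝓐 t ind
  open Degree 𝓐 t using (Tpow-resp; Tpow-zero)
  open import Data.Nat.DivMod using (m%n<n)
  open import Relation.Nullary.Decidable using (decidable-stable; ¬?)

  private
    module U (i : Fin (suc n)) = Unitriangular 𝓐 t (rank i) (rank-injective i)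
    open U using (IsUnitriangular)
    open U.IsUnitriangular

  Avoided : Fin (suc n) → Set
  Avoided i = ∀ q → ind q ≢ i

  avoided-exists : p < n → ∃ Avoided
  avoided-exists p<n with F.¬∀⟶∃¬ (suc n) (λ i → ∃ λ q → ind q ≡ i) (λ i → F.any? (λ q → ind q F.≟ i)) notOnto
    where
    notOnto : ¬ (∀ i → ∃ λ q → ind q ≡ i)
    notOnto onto with F.pigeonhole (s≤s p<n) (λ i → proj₁ (onto i))
    ... | i , j , i<j , qᵢ≡qⱼ =
      F.<-irrefl (≡.trans (≡.sym (proj₂ (onto i))) (≡.trans (≡.cong ind qᵢ≡qⱼ) (proj₂ (onto j)))) i<j
  ... | i , notHit = i , λ q indq≡i → notHit (q , indq≡i)

  K₁⇒unitriangular : ∀ i {X} → K₁ 𝓐 t i X → IsUnitriangular i X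
  K₁⇒unitriangular i = SubgroupK.K⇒unitriangular 𝓐 t i (rank i) (rank-injective i) (Rank.rank-suc i)

  unitriangular⇒K₁ : ∀ i {X} → IsUnitriangular i X → K₁ 𝓐 t i X
  unitriangular⇒K₁ i = SubgroupK.unitriangular⇒K 𝓐 t i (rank i) (rank-injective i) (Rank.rank-suc i)
                         (Rank.rank-bound i) (Rank.rank-top i) (Rank.rank-surjective i)

  private
    Hit : Fin (suc n) → ℕ → Set
    Hit k m = ∃ λ q → F.toℕ (ind q) ≡ (F.toℕ k ℕ.+ m) % suc n

    hit? : ∀ k m → Dec (Hit k m)
    hit? k m = F.any? (λ q → F.toℕ (ind q) ℕ.≟ (F.toℕ k ℕ.+ m) % suc n)

  cycIn? : ∀ k j → Dec (CycIn k j)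
  cycIn? k j with ℕ.allUpTo? (hit? k) (dist k j)
  ... | yes all = yes λ m m<d → all m<d
  ... | no ¬all = no λ cyc → ¬all (λ {m} m<d → cyc m m<d)

  cycIn⇒¬descending : ∀ {i k j} → Avoided i → CycIn k j → ¬ (rank i j < rank i k)
  cycIn⇒¬descending {i} {k} {j} i-avoided cyc rj<rk with cyc _ (Rank.descending⇒passes-i i rj<rk)
  ... | q , indq≡ = i-avoided q (F.toℕ-injective (≡.trans indq≡ (+δ (F.toℕ<n k) (F.toℕ<n i))))

  ¬cycIn⇒descending : ∀ {k j} → k ≢ j → ¬ CycIn k j → ∃ λ i → Avoided i × rank i j < rank i k
  ¬cycIn⇒descending {k} {j} k≢j ¬cyc with ℕ.anyUpTo? (¬? ∘ hit? k) (dist k j)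
  ... | no none = ⊥-elim (¬cyc λ m m<d → decidable-stable (hit? k m) (λ ¬hit → none (m , m<d , ¬hit)))
  ... | yes (m , m<d , ¬hit) = i , i-avoided , descending (ℕ.<-cmp (rank i k) (rank i j))
    where
    i = F.fromℕ< (m%n<n (F.toℕ k ℕ.+ m) (suc n))
    toℕ-i : F.toℕ i ≡ (F.toℕ k ℕ.+ m) % suc n
    toℕ-i = F.toℕ-fromℕ< _
    i-avoided : Avoided i
    i-avoided q indq≡i = ¬hit (q , ≡.trans (≡.cong F.toℕ indq≡i) toℕ-i)
    descending : Tri (rank i k < rank i j) (rank i k ≡ rank i j) (rank i j < rank i k) → rank i j < rank i k
    descending (tri< rk<rj _ _) = ⊥-elim (Rank.ascending⇒avoids-i i rk<rj m<d (≡.sym toℕ-i))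
    descending (tri≈ _ rk≡rj _) = ⊥-elim (k≢j (rank-injective i rk≡rj))
    descending (tri> _ _ rj<rk) = rj<rk

  hasShape⇒unitriangular : ∀ {i X} → Avoided i → HasShape X → IsUnitriangular i X
  hasShape⇒unitriangular {i} {X} i-avoided shape = record
    { diagonal = λ k → proj₁ (shape k k) ≡.refl
    ; above    = above′
    ; below    = λ k j rj<rk →
        proj₂ (proj₂ (shape k j)) (λ k≡j → U.<⇒≢ i rj<rk (≡.sym k≡j)) (λ cyc → cycIn⇒¬descending i-avoided cyc rj<rk) }
    where
    above′ : ∀ k j → rank i k < rank i j → Tpow 𝓐 t (rank i j ∸ rank i k) (X k j)
    above′ k j rk<rj with cycIn? k j
    ... | yes cyc = ≡.subst (λ d → Tpow 𝓐 t d (X k j)) (Rank.δ-ascending i (ℕ.<⇒≤ rk<rj))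
                            (proj₁ (proj₂ (shape k j)) (U.<⇒≢ i rk<rj) cyc)
    ... | no ¬cyc = Tpow-resp (sym (proj₂ (proj₂ (shape k j)) (U.<⇒≢ i rk<rj) ¬cyc)) (Tpow-zero _)

  unitriangular⇒hasShape : ∀ {X} → ∃ Avoided → (∀ i → Avoided i → IsUnitriangular i X) → HasShape X
  unitriangular⇒hasShape {X} (i₀ , i₀-avoided) unitriangular k j = diagonal′ , cycIn⇒degree , ¬cycIn⇒zero
    where
    diagonal′ : k ≡ j → X k j ≈ 1#
    diagonal′ ≡.refl = diagonal (unitriangular i₀ i₀-avoided) k
    cycIn⇒degree : k ≢ j → CycIn k j → Tpow 𝓐 t (dist k j) (X k j)
    cycIn⇒degree _ cyc = ≡.subst (λ d → Tpow 𝓐 t d (X k j)) (≡.sym (Rank.δ-ascending i₀ rk≤rj))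
                                 (above-or-on i₀ (unitriangular i₀ i₀-avoided) k j rk≤rj)
      where
      rk≤rj : rank i₀ k ≤ rank i₀ j
      rk≤rj = ℕ.≮⇒≥ (cycIn⇒¬descending i₀-avoided cyc)
    ¬cycIn⇒zero : k ≢ j → ¬ CycIn k j → X k j ≈ 0#
    ¬cycIn⇒zero k≢j ¬cyc with ¬cycIn⇒descending k≢j ¬cyc
    ... | i , i-avoided , rj<rk = below (unitriangular i i-avoided) k j rj<rk

corollary3p3 : ∀ {c ℓ a ℓa} (R : CommutativeRing c ℓ) (𝓐 : Algebra R a ℓa)
    (l : ℕ) (t : Fin l → Car 𝓐) → Generates 𝓐 t →
    (n : ℕ) → 2 ≤ n → (p : ℕ) → p < n →
    (ind : Fin (suc p) → Fin (suc n)) → (∀ q r → q F.< r → ind q F.< ind r) →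
    (X : Mat 𝓐 (suc n)) →
    let τ = λ (i : Fin (suc n)) → ∀ q → ind q ≢ i in
    (Kτ 𝓐 t τ X → Shape.HasShape 𝓐 t ind X)
    × (Shape.HasShape 𝓐 t ind X → Kτ 𝓐 t τ X)
corollary3p3 R 𝓐 l t _ n _ p p<n ind _ X =
    (λ X∈Kτ → unitriangular⇒hasShape 𝓐 t ind (avoided-exists 𝓐 t ind p<n)
                (λ i i-avoided → K₁⇒unitriangular 𝓐 t ind i (X∈Kτ i i-avoided)))
  , (λ shape i i-avoided → unitriangular⇒K₁ 𝓐 t ind i (hasShape⇒unitriangular 𝓐 t ind i-avoided shape))
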